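{- For every $M\in\Lambda^{001}_\infty$, $\mathrm{BT}(M)$ is in β⊥-normal form, i.e. there is no $N$ with $\mathrm{BT}(M)\to_{\beta\bot}N$.
   Context: Fix an infinite set $\mathcal V$ of variables. $\Lambda^{001}_{\bot\infty}=\nu Y.\mu X.(\mathcal V+\lambda\mathcal V.X+(X)Y+\bot)$ is the set of possibly infinite syntax trees built from variables, abstractions $\lambda x.M$, applications $(M)N$ and a constant $\bot$, in which every infinite branch passes infinitely often through the argument (right) subterm of an application; $\Lambda^{001}_\infty$ is the subset without $\bot$. Terms are up to α-equivalence. $\to_\beta^\infty$ is the 001-strongly convergent closure of β-reduction: $M\to_\beta^\infty x$ if $M\to_\beta^*x$; $M\to_\beta^\infty\lambda x.P'$ if $M\to_\beta^*\lambda x.P$, $P\to_\beta^\infty P'$; $M\to_\beta^\infty(P')Q'$ if $M\to_\beta^*(P)Q$, $P\to_\beta^\infty P'$, $Q\to_\beta^\infty Q'$, with possibly infinite derivations in which every infinite branch passes infinitely often through the premise $Q\to_\beta^\infty Q'$. $M$ is solvable if there are variables $x_1,\dots,x_m$ and terms $N_1,\dots,N_n$ with $(\dots((\lambda x_1\dots\lambda x_m.M)N_1)\dots)N_n\to_\beta^\infty\lambda x.x$, unsolvable otherwise. $\to_{\beta\bot}$ is the contextual closure (under $\lambda$, left and right of application) of $\beta_0\cup\bot_0$, where $\beta_0=\{((\lambda x.M)N,M[N/x])\}$ and $\bot_0=\{(M,\bot)\mid M\text{ unsolvable}\}\cup\{(\lambda x.\bot,\bot)\}\cup\{((\bot)M,\bot)\}$.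 Head normal forms are terms $\lambda x_1\dots\lambda x_m.(\dots((y)Q_1)\dots)Q_n$; otherwise a term is $\lambda x_1\dots\lambda x_m.(\dots(((\lambda z.N)P)Q_1)\dots)Q_n$ and head reduction $\to_h$ fires $(\lambda z.N)P$. The Böhm tree is defined corecursively: $\mathrm{BT}(M)=\bot$ if $M$ is unsolvable; if $M$ is solvable and $M\to_h^*\lambda x_1\dots\lambda x_m.(\dots((y)M_1)\dots)M_n$ then $\mathrm{BT}(M)=\lambda x_1\dots\lambda x_m.(\dots((y)\mathrm{BT}(M_1))\dots)\mathrm{BT}(M_n)$. -}

module Defs where

open import Data.Nat using (ℕ; zero; suc; _≟_; _≤_)
open import Data.List using (List; []; _∷_; foldl; foldr; _++_; [_]; length)
open import Data.List.Relation.Unary.All using (All)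
open import Data.Product using (Σ; _×_)
open import Data.Unit using (⊤)
open import Data.Empty using (⊥)
open import Function.Bundles using (_⇔_)
open import Relation.Nullary using (¬_; yes; no)
open import Relation.Binary.PropositionalEquality using (_≡_)

-- Coinduction (--guardedness / --sized-types) is unavailable, so
-- possibly infinite syntax trees are represented as functions from tree
-- positions to node labels.  A position is the list of directions taken
-- from the root: L = function part of an application, R = argument
-- part of an application, B = body of an abstraction.
-- Variables: de Bruijn indices (terms up to α-equivalence; ℕ is the
-- infinite set of variables).

data Dir : Set where
  L R B : Dir

Pos : Set
Pos = List Dir

data Node : Set where
  nvar : ℕ → Node
  nlam : Node
  napp : Node
  nbot : Node
  none : Node        -- "no node at this position"

Tm : Set
Tm = Pos → Node

_≈_ : Tm → Tm → Set
t ≈ u = ∀ p → t p ≡ u p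

infix 4 _≈_

var : ℕ → Tm
var x []      = nvar x
var x (_ ∷ _) = none

lam : Tm → Tm
lam M []      = nlam
lam M (B ∷ p) = M p
lam M (L ∷ p) = none
lam M (R ∷ p) = none

app : Tm → Tm → Tm
app M N []      = napp
app M N (L ∷ p) = M p
app M N (R ∷ p) = N p
app M N (B ∷ p) = none

bot : Tm
bot []      = nbot
bot (_ ∷ _) = none

sub : Dir → Tm → Tm
sub d t p = t (d ∷ p)

-- Well-formedness: Λ^{001}_{⊥∞} = νY.μX.(V + λV.X + (X)Y + ⊥).

Defined : Node → Set
Defined none = ⊥
Defined _    = ⊤

Allows : Node → Dir → Set
Allows nlam B = ⊤
Allows napp L = ⊤
Allows napp R = ⊤
Allows _    _ = ⊥

NoRight : Pos → Set
NoRight q = All (λ d → ¬ (d ≡ R)) q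

record WF (t : Tm) : Set where
  field
    root-defined : Defined (t [])
    children     : ∀ p d → Defined (t (p ++ [ d ])) ⇔ Allows (t p) d
    -- the part reachable from any node without entering an argument
    -- position is finite (inductive μX-layer): every infinite branch
    -- passes infinitely often through the argument of an application
    layer-finite : ∀ p → Σ ℕ λ k → ∀ q → NoRight q → k ≤ length q →
                   t (p ++ q) ≡ none

BotFree : Tm → Set
BotFree t = ∀ p → ¬ (t p ≡ nbot)

ext : (ℕ → ℕ) → ℕ → ℕ
ext ρ zero    = zero
ext ρ (suc n) = suc (ρ n)

renNode : (ℕ → ℕ) → Node → Node
renNode ρ (nvar x) = nvar (ρ x)
renNode ρ n        = n

rename : (ℕ → ℕ) → Tm → Tm
rename ρ t []      = renNode ρ (t [])
rename ρ t (d ∷ p) = rename' d (t [])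
  where
  rename' : Dir → Node → Node
  rename' B nlam = rename (ext ρ) (sub B t) p
  rename' L napp = rename ρ (sub L t) p
  rename' R napp = rename ρ (sub R t) p
  rename' _ _    = none

exts : (ℕ → Tm) → ℕ → Tm
exts σ zero    = var zero
exts σ (suc n) = rename suc (σ n)

subst : (ℕ → Tm) → Tm → Tm
subst σ t []      = subst₀ (t [])
  where
  subst₀ : Node → Node
  subst₀ (nvar x) = σ x []
  subst₀ n        = n
subst σ t (d ∷ p) = subst' d (t [])
  where
  subst' : Dir → Node → Node
  subst' d (nvar x) = σ x (d ∷ p)
  subst' B nlam     = subst (exts σ) (sub B t) p
  subst' L napp     = subst σ (sub L t) p
  subst' R napp     = subst σ (sub R t) p
  subst' _ _        = none

single : Tm → ℕ → Tm
single N zero    = N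
single N (suc n) = var n

-- M[N/x], x the variable bound by the λ whose body is M
_[_/0] : Tm → Tm → Tm
M [ N /0] = subst (single N) M

-- β-reduction (contextual closure of β₀; every rule is closed under ≈).

infix 4 _→β_ _→β*_ _⇒[_]_ _⇒R[_]_ _⇒β∞_ _→β⊥_ _→h_ _→h*_ _→hb_

data _→β_ : Tm → Tm → Set where
  β₀   : ∀ {M M' P Q} → M ≈ app (lam P) Q → M' ≈ P [ Q /0] → M →β M'
  ξlam : ∀ {M M' P P'} → M ≈ lam P → P →β P' → M' ≈ lam P' → M →β M'
  ξl   : ∀ {M M' P P' Q} → M ≈ app P Q → P →β P' → M' ≈ app P' Q → M →β M'
  ξr   : ∀ {M M' P Q Q'} → M ≈ app P Q → Q →β Q' → M' ≈ app P Q' → M →β M'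

data _→β*_ : Tm → Tm → Set where
  ε   : ∀ {M M'} → M ≈ M' → M →β* M'
  _◅_ : ∀ {M M' M''} → M →β M' → M' →β* M'' → M →β* M''

-- 001-strongly convergent closure →β^∞.  Its (possibly infinite)
-- derivations are represented by their finite approximations:
-- M ⇒[ n ] M' is a derivation cut off after n passes through the
-- premise Q →β^∞ Q' (the argument premise).
mutual
  data _⇒[_]_ : Tm → ℕ → Tm → Set where
    ⇒var : ∀ {M M' n x} → M →β* var x → M' ≈ var x → M ⇒[ n ] M'
    ⇒lam : ∀ {M M' n P P'} → M →β* lam P → P ⇒[ n ] P' → M' ≈ lam P' →
           M ⇒[ n ] M'
    ⇒app : ∀ {M M' n P P' Q Q'} → M →β* app P Q → P ⇒[ n ] P' →
           Q ⇒R[ n ] Q' → M' ≈ app P' Q' → M ⇒[ n ] M'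

  data _⇒R[_]_ : Tm → ℕ → Tm → Set where
    cut  : ∀ {Q Q'} → Q ⇒R[ zero ] Q'
    more : ∀ {Q Q' n} → Q ⇒[ n ] Q' → Q ⇒R[ suc n ] Q'

_⇒β∞_ : Tm → Tm → Set
M ⇒β∞ M' = ∀ n → M ⇒[ n ] M'

-- λx.M for a variable x: x becomes the bound index 0, every other free
-- variable y becomes suc y.
bindVar : ℕ → ℕ → ℕ
bindVar x y with y ≟ x
... | yes _ = zero
... | no  _ = suc y

abs : ℕ → Tm → Tm
abs x M = lam (rename (bindVar x) M)

abss : List ℕ → Tm → Tm
abss xs M = foldr abs M xs

apps : Tm → List Tm → Tm
apps M Ns = foldl app M Ns

idTm : Tm
idTm = lam (var zero)

Solvable : Tm → Set
Solvable M = Σ (List ℕ) λ xs → Σ (List Tm) λ Ns →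
             All WF Ns × (apps (abss xs M) Ns ⇒β∞ idTm)

Unsolvable : Tm → Set
Unsolvable M = ¬ Solvable M

data _→β⊥_ : Tm → Tm → Set where
  β₀    : ∀ {M M' P Q} → M ≈ app (lam P) Q → M' ≈ P [ Q /0] → M →β⊥ M'
  ⊥unsv : ∀ {M M'} → ¬ (M ≈ bot) → Unsolvable M → M' ≈ bot → M →β⊥ M'
  ⊥lam  : ∀ {M M'} → M ≈ lam bot → M' ≈ bot → M →β⊥ M'
  ⊥app  : ∀ {M M' Q} → M ≈ app bot Q → M' ≈ bot → M →β⊥ M'
  ξlam  : ∀ {M M' P P'} → M ≈ lam P → P →β⊥ P' → M' ≈ lam P' → M →β⊥ M'
  ξl    : ∀ {M M' P P' Q} → M ≈ app P Q → P →β⊥ P' → M' ≈ app P' Q → M →β⊥ M'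
  ξr    : ∀ {M M' P Q Q'} → M ≈ app P Q → Q →β⊥ Q' → M' ≈ app P Q' → M →β⊥ M'

data _→hb_ : Tm → Tm → Set where
  hβ   : ∀ {M M' N P} → M ≈ app (lam N) P → M' ≈ N [ P /0] → M →hb M'
  happ : ∀ {M M' H H' Q} → M ≈ app H Q → H →hb H' → M' ≈ app H' Q → M →hb M'

data _→h_ : Tm → Tm → Set where
  hbody : ∀ {M M'} → M →hb M' → M →h M'
  hlam  : ∀ {M M' H H'} → M ≈ lam H → H →h H' → M' ≈ lam H' → M →h M'

data _→h*_ : Tm → Tm → Set where
  ε   : ∀ {M M'} → M ≈ M' → M →h* M'
  _◅_ : ∀ {M M' M''} → M →h M' → M' →h* M'' → M →h* M''

-- Böhm trees, as a relation  IsBT M T  meaning  BT(M) = T: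
--   BT(M) = ⊥ if M is unsolvable;
--   if M is solvable and M →h* λx₁…λxₘ.(…((y)M₁)…)Mₙ then
--   BT(M) = λx₁…λxₘ.(…((y)BT(M₁))…)BT(Mₙ).
-- The corecursive definition is represented by its approximations:
-- IsBT[ n ] M T checks the defining clauses down to n passes through
-- argument positions.

mutual
  data IsBT[_] : ℕ → Tm → Tm → Set where
    bt-unsolvable : ∀ {n M T} → Unsolvable M → T ≈ bot → IsBT[ n ] M T
    bt-solvable   : ∀ {n M H T} → Solvable M → M →h* H → BTLam n H T →
                    IsBT[ n ] M T

  data BTLam : ℕ → Tm → Tm → Set where
    btl-lam   : ∀ {n H H' T T'} → H ≈ lam H' → T ≈ lam T' → BTLam n H' T' →
                BTLam n H T
    btl-spine : ∀ {n H T} → BTSpine n H T → BTLam n H T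

  data BTSpine : ℕ → Tm → Tm → Set where
    bts-var : ∀ {n H T y} → H ≈ var y → T ≈ var y → BTSpine n H T
    bts-app : ∀ {n H H' T T' N U} → H ≈ app H' N → T ≈ app T' U →
              BTSpine n H' T' → BTArg n N U → BTSpine n H T

  data BTArg : ℕ → Tm → Tm → Set where
    cut  : ∀ {N U} → BTArg zero N U
    more : ∀ {n N U} → IsBT[ n ] N U → BTArg (suc n) N U

IsBT : Tm → Tm → Set
IsBT M T = ∀ n → IsBT[ n ] M T

-- A Böhm tree is either ⊥, which no rule rewrites (⊥₀ only fires on terms
-- other than ⊥), or a head normal form λx₁…λxₘ.(y)T₁…Tₖ whose arguments are
-- again Böhm trees.  Such a head normal form has no β-redex and no ⊥-redex
-- at its root or along its spine, and it is solvable: bind y if it is free,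
-- then substitute λz₁…λzₖ.λx.x for it, so that the k arguments are discarded
-- and λx.x remains.  Hence a β⊥-step could only take place inside some Tᵢ,
-- and induction on the step, reading the Böhm tree through an approximation
-- deep enough to reach the redex, shows that there is none.  Nothing about M
-- is used beyond IsBT M T.
module Submission where

open import Defs
open import Data.Empty using (⊥-elim)
open import Data.List using (List; []; _∷_; [_]; _++_; map; length; replicate)
open import Data.List.Properties using (length-map)
open import Data.List.Relation.Unary.All as All using (All)
open import Data.List.Relation.Unary.All.Properties using (replicate⁺)
open import Data.Nat using (ℕ; zero; suc; _+_; _∸_; _<_; _≤_; s≤s; _<?_; _≟_)
open import Data.Nat.Properties
  using (m≤n⇒m<n∨m≡n; m+[n∸m]≡n; +-suc; +-identityʳ; ≮⇒≥; n<1+n)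
open import Data.Product using (Σ; ∃; ∃₂; _×_; _,_)
open import Data.Sum using (_⊎_; inj₁; inj₂)
open import Data.Unit using (tt)
open import Function.Base using (id)
open import Function.Bundles using (_⇔_; mk⇔)
open import Relation.Nullary using (¬_; yes; no)
open import Relation.Binary.Bundles using (Setoid)
open import Relation.Binary.PropositionalEquality
  using (_≡_; refl; sym; trans; cong; module ≡-Reasoning)
import Relation.Binary.Reasoning.Setoid as SetoidReasoning

private
  variable
    n m h k : ℕ
    t u v M N H P P' Q Q' T U W : Tm

≈-refl : t ≈ t
≈-refl _ = refl

≈-sym : t ≈ u → u ≈ t
≈-sym e p = sym (e p)

≈-trans : t ≈ u → u ≈ v → t ≈ v
≈-trans e f p = trans (e p) (f p)

lam-cong : P ≈ P' → lam P ≈ lam P'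
lam-cong e []      = refl
lam-cong e (B ∷ p) = e p
lam-cong e (L ∷ p) = refl
lam-cong e (R ∷ p) = refl

app-cong : P ≈ P' → Q ≈ Q' → app P Q ≈ app P' Q'
app-cong e f []      = refl
app-cong e f (L ∷ p) = e p
app-cong e f (R ∷ p) = f p
app-cong e f (B ∷ p) = refl

lam-injective : lam P ≈ lam P' → P ≈ P'
lam-injective e p = e (B ∷ p)

app-injective : app P Q ≈ app P' Q' → P ≈ P' × Q ≈ Q'
app-injective e = (λ p → e (L ∷ p)) , (λ p → e (R ∷ p))

var-cong : h ≡ k → var h ≈ var k
var-cong refl = ≈-refl

≈-setoid : Setoid _ _
≈-setoid = record
  { Carrier       = Tm
  ; _≈_           = _≈_
  ; isEquivalence = record { refl = ≈-refl ; sym = ≈-sym ; trans = ≈-trans }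
  }

module ≈-Reasoning = SetoidReasoning ≈-setoid

lamⁿ : ℕ → Tm → Tm
lamⁿ zero    P = P
lamⁿ (suc m) P = lam (lamⁿ m P)

-- spine H (Aₖ ∷ … ∷ A₁ ∷ []) = (…((H)A₁)…)Aₖ
spine : Tm → List Tm → Tm
spine H []       = H
spine H (A ∷ As) = app (spine H As) A

lamⁿ-cong : ∀ m → P ≈ P' → lamⁿ m P ≈ lamⁿ m P'
lamⁿ-cong zero    e = e
lamⁿ-cong (suc m) e = lam-cong (lamⁿ-cong m e)

spine-cong : ∀ As → H ≈ P → spine H As ≈ spine P As
spine-cong []       e = e
spine-cong (A ∷ As) e = app-cong (spine-cong As e) ≈-refl

discard : ℕ → Tm
discard k = lamⁿ k idTm

subst-cong : ∀ σ → t ≈ u → subst σ t ≈ subst σ u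
subst-cong σ e [] rewrite e [] = refl
subst-cong {t = t} {u = u} σ e (d ∷ p) with t [] | u [] | e [] | d
... | nvar _ | _ | refl | _ = refl
... | nlam   | _ | refl | B = subst-cong (exts σ) (λ q → e (B ∷ q)) p
... | nlam   | _ | refl | L = refl
... | nlam   | _ | refl | R = refl
... | napp   | _ | refl | B = refl
... | napp   | _ | refl | L = subst-cong σ (λ q → e (L ∷ q)) p
... | napp   | _ | refl | R = subst-cong σ (λ q → e (R ∷ q)) p
... | nbot   | _ | refl | _ = refl
... | none   | _ | refl | _ = refl

rename-cong : ∀ ρ → t ≈ u → rename ρ t ≈ rename ρ u
rename-cong ρ e [] rewrite e [] = refl
rename-cong {t = t} {u = u} ρ e (d ∷ p) with d | t [] | u [] | e []
... | B | nlam | _ | refl = rename-cong (ext ρ) (λ q → e (B ∷ q)) p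
... | L | napp | _ | refl = rename-cong ρ (λ q → e (L ∷ q)) p
... | R | napp | _ | refl = rename-cong ρ (λ q → e (R ∷ q)) p
... | B | nvar _ | _ | refl = refl
... | B | napp   | _ | refl = refl
... | B | nbot   | _ | refl = refl
... | B | none   | _ | refl = refl
... | L | nvar _ | _ | refl = refl
... | L | nlam   | _ | refl = refl
... | L | nbot   | _ | refl = refl
... | L | none   | _ | refl = refl
... | R | nvar _ | _ | refl = refl
... | R | nlam   | _ | refl = refl
... | R | nbot   | _ | refl = refl
... | R | none   | _ | refl = refl

subst-var : ∀ σ x → subst σ (var x) ≈ σ x
subst-var σ x []      = refl
subst-var σ x (_ ∷ _) = refl

subst-lam : ∀ σ P → subst σ (lam P) ≈ lam (subst (exts σ) P)
subst-lam σ P []      = refl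
subst-lam σ P (B ∷ _) = refl
subst-lam σ P (L ∷ _) = refl
subst-lam σ P (R ∷ _) = refl

subst-app : ∀ σ P Q → subst σ (app P Q) ≈ app (subst σ P) (subst σ Q)
subst-app σ P Q []      = refl
subst-app σ P Q (B ∷ _) = refl
subst-app σ P Q (L ∷ _) = refl
subst-app σ P Q (R ∷ _) = refl

rename-var : ∀ ρ x → rename ρ (var x) ≈ var (ρ x)
rename-var ρ x []      = refl
rename-var ρ x (B ∷ _) = refl
rename-var ρ x (L ∷ _) = refl
rename-var ρ x (R ∷ _) = refl

rename-lam : ∀ ρ P → rename ρ (lam P) ≈ lam (rename (ext ρ) P)
rename-lam ρ P []      = refl
rename-lam ρ P (B ∷ _) = refl
rename-lam ρ P (L ∷ _) = refl
rename-lam ρ P (R ∷ _) = refl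

rename-app : ∀ ρ P Q → rename ρ (app P Q) ≈ app (rename ρ P) (rename ρ Q)
rename-app ρ P Q []      = refl
rename-app ρ P Q (B ∷ _) = refl
rename-app ρ P Q (L ∷ _) = refl
rename-app ρ P Q (R ∷ _) = refl

extsⁿ : ℕ → (ℕ → Tm) → ℕ → Tm
extsⁿ zero    σ = σ
extsⁿ (suc j) σ = extsⁿ j (exts σ)

extⁿ : ℕ → (ℕ → ℕ) → ℕ → ℕ
extⁿ zero    ρ = ρ
extⁿ (suc j) ρ = extⁿ j (ext ρ)

subst-lamⁿ : ∀ m σ P → subst σ (lamⁿ m P) ≈ lamⁿ m (subst (extsⁿ m σ) P)
subst-lamⁿ zero    σ P = ≈-refl
subst-lamⁿ (suc m) σ P =
  ≈-trans (subst-lam σ (lamⁿ m P)) (lam-cong (subst-lamⁿ m (exts σ) P))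

rename-lamⁿ : ∀ m ρ P → rename ρ (lamⁿ m P) ≈ lamⁿ m (rename (extⁿ m ρ) P)
rename-lamⁿ zero    ρ P = ≈-refl
rename-lamⁿ (suc m) ρ P =
  ≈-trans (rename-lam ρ (lamⁿ m P)) (lam-cong (rename-lamⁿ m (ext ρ) P))

subst-spine : ∀ σ H As → subst σ (spine H As) ≈ spine (subst σ H) (map (subst σ) As)
subst-spine σ H []       = ≈-refl
subst-spine σ H (A ∷ As) =
  ≈-trans (subst-app σ (spine H As) A) (app-cong (subst-spine σ H As) ≈-refl)

rename-spine : ∀ ρ H As → rename ρ (spine H As) ≈ spine (rename ρ H) (map (rename ρ) As)
rename-spine ρ H []       = ≈-refl
rename-spine ρ H (A ∷ As) =
  ≈-trans (rename-app ρ (spine H As) A) (app-cong (rename-spine ρ H As) ≈-refl)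

subst-discard : ∀ k σ → subst σ (discard k) ≈ discard k
subst-discard zero    σ =
  ≈-trans (subst-lam σ (var zero)) (lam-cong (subst-var (exts σ) zero))
subst-discard (suc k) σ =
  ≈-trans (subst-lam σ (discard k)) (lam-cong (subst-discard k (exts σ)))

rename-discard : ∀ k ρ → rename ρ (discard k) ≈ discard k
rename-discard zero    ρ =
  ≈-trans (rename-lam ρ (var zero)) (lam-cong (rename-var (ext ρ) zero))
rename-discard (suc k) ρ =
  ≈-trans (rename-lam ρ (discard k)) (lam-cong (rename-discard k (ext ρ)))

extsⁿ-exts : ∀ j σ x → extsⁿ j (exts σ) x ≈ exts (extsⁿ j σ) x
extsⁿ-exts zero    σ x = ≈-refl
extsⁿ-exts (suc j) σ x = extsⁿ-exts j (exts σ) x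

extsⁿ-bound : ∀ j σ h → h < j → extsⁿ j σ h ≈ var h
extsⁿ-bound (suc j) σ zero    _         = extsⁿ-exts j σ zero
extsⁿ-bound (suc j) σ (suc h) (s≤s h<j) =
  ≈-trans (extsⁿ-exts j σ (suc h))
          (≈-trans (rename-cong suc (extsⁿ-bound j σ h h<j)) (rename-var suc h))

extsⁿ-single-discard : ∀ j k → extsⁿ j (single (discard k)) j ≈ discard k
extsⁿ-single-discard zero    k = ≈-refl
extsⁿ-single-discard (suc j) k =
  ≈-trans (extsⁿ-exts j (single (discard k)) (suc j))
          (≈-trans (rename-cong suc (extsⁿ-single-discard j k)) (rename-discard k suc))

extⁿ-ext : ∀ j ρ x → extⁿ j (ext ρ) x ≡ ext (extⁿ j ρ) x
extⁿ-ext zero    ρ x = refl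
extⁿ-ext (suc j) ρ x = extⁿ-ext j (ext ρ) x

extⁿ-+ : ∀ m ρ x → extⁿ m ρ (m + x) ≡ m + ρ x
extⁿ-+ zero    ρ x = refl
extⁿ-+ (suc m) ρ x = trans (extⁿ-ext m ρ (suc (m + x))) (cong suc (extⁿ-+ m ρ x))

bindVar-self : ∀ x → bindVar x x ≡ zero
bindVar-self x with x ≟ x
... | yes _  = refl
... | no x≢x = ⊥-elim (x≢x refl)

→β-respˡ : t ≈ u → u →β v → t →β v
→β-respˡ e (β₀ a b)     = β₀ (≈-trans e a) b
→β-respˡ e (ξlam a s b) = ξlam (≈-trans e a) s b
→β-respˡ e (ξl a s b)   = ξl (≈-trans e a) s b
→β-respˡ e (ξr a s b)   = ξr (≈-trans e a) s b

_◅◅_ : t →β* u → u →β* v → t →β* v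
ε e     ◅◅ (s ◅ r') = →β-respˡ e s ◅ r'
ε e     ◅◅ ε f      = ε (≈-trans e f)
(s ◅ r) ◅◅ r'       = s ◅ (r ◅◅ r')

apps-ξ : ∀ Ns → t →β u → apps t Ns →β apps u Ns
apps-ξ []       s = s
apps-ξ (N ∷ Ns) s = apps-ξ Ns (ξl ≈-refl s ≈-refl)

app-ξ* : t →β* u → app t Q →β* app u Q
app-ξ* (ε e)   = ε (app-cong e ≈-refl)
app-ξ* (s ◅ r) = ξl ≈-refl s ≈-refl ◅ app-ξ* r

-- Head normal forms are solvable

discard-spine : ∀ As k → n ≡ length As + k → spine (discard n) As →β* discard k
discard-spine []       k refl = ε ≈-refl
discard-spine (A ∷ As) k e    =
  app-ξ* (discard-spine As (suc k) (trans e (sym (+-suc (length As) k))))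
  ◅◅ (β₀ ≈-refl (≈-sym (subst-discard k (single A))) ◅ ε ≈-refl)

DiscardOrBound : ℕ → ℕ → Tm → Set
DiscardOrBound k j H = H ≈ discard k ⊎ ∃ λ h → h < j × H ≈ var h

DiscardOrBound-subst : ∀ k j → DiscardOrBound k (suc j) H →
  DiscardOrBound k j (subst (extsⁿ j (single (discard k))) H)
DiscardOrBound-subst k j (inj₁ e) = inj₁ (≈-trans (subst-cong _ e) (subst-discard k _))
DiscardOrBound-subst k j (inj₂ (h , s≤s h≤j , e)) with m≤n⇒m<n∨m≡n h≤j
... | inj₁ h<j  = inj₂ (h , h<j ,
  ≈-trans (subst-cong _ e) (≈-trans (subst-var _ h) (extsⁿ-bound j _ h h<j)))
... | inj₂ refl = inj₁
  (≈-trans (subst-cong _ e) (≈-trans (subst-var _ h) (extsⁿ-single-discard h k)))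

apply-discards : ∀ k j As → W ≈ lamⁿ j (spine H As) → DiscardOrBound k j H →
  ∃ λ As' → length As' ≡ length As × apps W (replicate j (discard k)) →β* spine (discard k) As'
apply-discards k zero As w (inj₁ e)           = As , refl , ε (≈-trans w (spine-cong As e))
apply-discards k zero As w (inj₂ (_ , () , _))
apply-discards {H = H} k (suc j) As w hd
  with apply-discards k j (map (subst (extsⁿ j (single (discard k)))) As)
         (≈-trans (subst-lamⁿ j _ _) (lamⁿ-cong j (subst-spine _ H As)))
         (DiscardOrBound-subst k j hd)
... | As' , len , r =
  As' , trans len (length-map _ As) ,
  (apps-ξ (replicate j (discard k)) (β₀ (app-cong w ≈-refl) ≈-refl) ◅ r)

discards : ℕ → List Tm → List Tm
discards m As = replicate m (discard (length As))

bound-head-→β*-id : ∀ As → h < m → W ≈ lamⁿ m (spine (var h) As) →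
  apps W (discards m As) →β* idTm
bound-head-→β*-id {h} {m} As h<m w
  with apply-discards (length As) m As w (inj₂ (h , h<m , ≈-refl))
... | As' , len , r = r ◅◅ discard-spine As' 0 (sym (trans (+-identityʳ _) len))

WF-var : ∀ x → WF (var x)
WF-var x = record { root-defined = tt ; children = children ; layer-finite = layer-finite }
  where
  children : ∀ p d → Defined (var x (p ++ [ d ])) ⇔ Allows (var x p) d
  children []      B = mk⇔ id id
  children []      L = mk⇔ id id
  children []      R = mk⇔ id id
  children (_ ∷ _) _ = mk⇔ id id
  layer-finite : ∀ p → ∃ λ k → ∀ q → NoRight q → k ≤ length q → var x (p ++ q) ≡ none
  layer-finite []      = 1 , λ { [] _ () ; (_ ∷ _) _ _ → refl }
  layer-finite (_ ∷ _) = 0 , λ _ _ _ → refl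

WF-lam : WF P → WF (lam P)
WF-lam {P} wf = record { root-defined = tt ; children = children ; layer-finite = layer-finite }
  where
  module P = WF wf
  children : ∀ p d → Defined (lam P (p ++ [ d ])) ⇔ Allows (lam P p) d
  children []      B = mk⇔ (λ _ → tt) (λ _ → P.root-defined)
  children []      L = mk⇔ id id
  children []      R = mk⇔ id id
  children (B ∷ p) d = P.children p d
  children (L ∷ _) _ = mk⇔ id id
  children (R ∷ _) _ = mk⇔ id id
  layer-finite : ∀ p → ∃ λ k → ∀ q → NoRight q → k ≤ length q → lam P (p ++ q) ≡ none
  layer-finite [] with P.layer-finite []
  ... | k , finite = suc k , λ
    { [] _ ()
    ; (B ∷ q) (_ All.∷ nr) (s≤s k≤q) → finite q nr k≤q
    ; (L ∷ _) _ _ → refl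
    ; (R ∷ _) _ _ → refl }
  layer-finite (B ∷ p) = P.layer-finite p
  layer-finite (L ∷ _) = 0 , λ _ _ _ → refl
  layer-finite (R ∷ _) = 0 , λ _ _ _ → refl

WF-discard : ∀ k → WF (discard k)
WF-discard zero    = WF-lam (WF-var zero)
WF-discard (suc k) = WF-lam (WF-discard k)

→β*-id⇒solvable : ∀ xs Ns → All WF Ns → apps (abss xs T) Ns →β* idTm → Solvable T
→β*-id⇒solvable xs Ns wf r = xs , Ns , wf , λ _ → ⇒lam r (⇒var (ε ≈-refl) ≈-refl) ≈-refl

extⁿ-bindVar-self : ∀ m x → extⁿ m (bindVar x) (m + x) ≡ m
extⁿ-bindVar-self m x = begin
  extⁿ m (bindVar x) (m + x) ≡⟨ extⁿ-+ m (bindVar x) x ⟩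
  m + bindVar x x            ≡⟨ cong (m +_) (bindVar-self x) ⟩
  m + 0                      ≡⟨ +-identityʳ m ⟩
  m                          ∎
  where open ≡-Reasoning

abs-free-head : ∀ m x As → T ≈ lamⁿ m (spine (var (m + x)) As) →
  abs x T ≈ lamⁿ (suc m) (spine (var m) (map (rename (extⁿ m (bindVar x))) As))
abs-free-head {T} m x As e = lam-cong (begin
  rename (bindVar x) T
    ≈⟨ rename-cong _ e ⟩
  rename (bindVar x) (lamⁿ m (spine (var (m + x)) As))
    ≈⟨ rename-lamⁿ m _ _ ⟩
  lamⁿ m (rename bindₘ (spine (var (m + x)) As))
    ≈⟨ lamⁿ-cong m (rename-spine bindₘ _ As) ⟩
  lamⁿ m (spine (rename bindₘ (var (m + x))) (map (rename bindₘ) As))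
    ≈⟨ lamⁿ-cong m (spine-cong (map (rename bindₘ) As) head-bound) ⟩
  lamⁿ m (spine (var m) (map (rename bindₘ) As)) ∎)
  where
  bindₘ = extⁿ m (bindVar x)
  head-bound : rename bindₘ (var (m + x)) ≈ var m
  head-bound = ≈-trans (rename-var bindₘ _) (var-cong (extⁿ-bindVar-self m x))
  open ≈-Reasoning

hnf-solvable : ∀ m h As → T ≈ lamⁿ m (spine (var h) As) → Solvable T
hnf-solvable m h As e with h <? m
... | yes h<m =
  →β*-id⇒solvable [] (discards m As) (replicate⁺ m (WF-discard (length As)))
    (bound-head-→β*-id As h<m e)
... | no  h≮m =
  →β*-id⇒solvable [ h ∸ m ] (discards (suc m) As') (replicate⁺ (suc m) (WF-discard (length As')))
    (bound-head-→β*-id As' (n<1+n m) (abs-free-head m (h ∸ m) As e'))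
  where
  As' = map (rename (extⁿ m (bindVar (h ∸ m)))) As
  e'  = ≈-trans e (lamⁿ-cong m (spine-cong As (var-cong (sym (m+[n∸m]≡n (≮⇒≥ h≮m))))))

-- Böhm trees are β⊥-normal

spine-shape : BTSpine n H T → ∃₂ λ h As → T ≈ spine (var h) As
spine-shape (bts-var {y = y} _ eT) = y , [] , eT
spine-shape (bts-app _ eT S _) with spine-shape S
... | h , As , e = h , _ ∷ As , ≈-trans eT (app-cong e ≈-refl)

hnf-shape : BTLam n H T → ∃₂ λ m h → ∃ λ As → T ≈ lamⁿ m (spine (var h) As)
hnf-shape (btl-lam _ eT Lm) with hnf-shape Lm
... | m , h , As , e = suc m , h , As , ≈-trans eT (lam-cong e)
hnf-shape (btl-spine S) with spine-shape S
... | h , As , e = 0 , h , As , e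

BTLam-solvable : BTLam n H T → Solvable T
BTLam-solvable Lm with hnf-shape Lm
... | m , h , As , e = hnf-solvable m h As e

BTSpine-resp : T ≈ U → BTSpine n H T → BTSpine n H U
BTSpine-resp e (bts-var eH eT)     = bts-var eH (≈-trans (≈-sym e) eT)
BTSpine-resp e (bts-app eH eT S A) = bts-app eH (≈-trans (≈-sym e) eT) S A

BTLam-resp : T ≈ U → BTLam n H T → BTLam n H U
BTLam-resp e (btl-lam eH eT Lm) = btl-lam eH (≈-trans (≈-sym e) eT) Lm
BTLam-resp e (btl-spine S)      = btl-spine (BTSpine-resp e S)

IsBT-resp : T ≈ U → IsBT[ n ] M T → IsBT[ n ] M U
IsBT-resp e (bt-unsolvable u eT) = bt-unsolvable u (≈-trans (≈-sym e) eT)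
IsBT-resp e (bt-solvable s r Lm) = bt-solvable s r (BTLam-resp e Lm)

BTArg-resp : T ≈ U → BTArg n M T → BTArg n M U
BTArg-resp e cut      = cut
BTArg-resp e (more b) = more (IsBT-resp e b)

BTSpine-≉-lam : BTSpine n H T → ¬ T ≈ lam P
BTSpine-≉-lam (bts-var _ eT)     e with () ← ≈-trans (≈-sym e) eT []
BTSpine-≉-lam (bts-app _ eT _ _) e with () ← ≈-trans (≈-sym e) eT []

BTSpine-≉-bot : BTSpine n H T → ¬ T ≈ bot
BTSpine-≉-bot (bts-var _ eT)     e with () ← ≈-trans (≈-sym e) eT []
BTSpine-≉-bot (bts-app _ eT _ _) e with () ← ≈-trans (≈-sym e) eT []

BTLam-≉-bot : BTLam n H T → ¬ T ≈ bot
BTLam-≉-bot (btl-lam _ eT _) e with () ← ≈-trans (≈-sym e) eT []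
BTLam-≉-bot (btl-spine S)      = BTSpine-≉-bot S

BTLam-lam⁻¹ : BTLam n H T → T ≈ lam P → ∃ λ H' → BTLam n H' P
BTLam-lam⁻¹ (btl-lam _ eT Lm) e = _ , BTLam-resp (lam-injective (≈-trans (≈-sym eT) e)) Lm
BTLam-lam⁻¹ (btl-spine S)     e = ⊥-elim (BTSpine-≉-lam S e)

BTLam-app⁻¹ : BTLam n H T → T ≈ app P Q → ∃₂ λ H' N → BTSpine n H' P × BTArg n N Q
BTLam-app⁻¹ (btl-lam _ eT _)               e with () ← ≈-trans (≈-sym eT) e []
BTLam-app⁻¹ (btl-spine (bts-var _ eT))     e with () ← ≈-trans (≈-sym eT) e []
BTLam-app⁻¹ (btl-spine (bts-app _ eT S A)) e
  with eP , eQ ← app-injective (≈-trans (≈-sym eT) e) =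
  _ , _ , BTSpine-resp eP S , BTArg-resp eQ A

bot-irreducible : T ≈ bot → ¬ (T →β⊥ N)
bot-irreducible eT (β₀ e _)       with () ← ≈-trans (≈-sym eT) e []
bot-irreducible eT (⊥unsv T≉⊥ _ _) = T≉⊥ eT
bot-irreducible eT (⊥lam e _)     with () ← ≈-trans (≈-sym eT) e []
bot-irreducible eT (⊥app e _)     with () ← ≈-trans (≈-sym eT) e []
bot-irreducible eT (ξlam e _ _)   with () ← ≈-trans (≈-sym eT) e []
bot-irreducible eT (ξl e _ _)     with () ← ≈-trans (≈-sym eT) e []
bot-irreducible eT (ξr e _ _)     with () ← ≈-trans (≈-sym eT) e []

argument-depth : T →β⊥ N → ℕ
argument-depth (β₀ _ _)      = 0
argument-depth (⊥unsv _ _ _) = 0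
argument-depth (⊥lam _ _)    = 0
argument-depth (⊥app _ _)    = 0
argument-depth (ξlam _ D _)  = argument-depth D
argument-depth (ξl _ D _)    = argument-depth D
argument-depth (ξr _ D _)    = suc (argument-depth D)

mutual
  IsBT-irreducible : IsBT[ n ] M T → (D : T →β⊥ N) → ¬ argument-depth D < n
  IsBT-irreducible (bt-unsolvable _ eT) D _   = bot-irreducible eT D
  IsBT-irreducible (bt-solvable _ _ Lm) D d<n = BTLam-irreducible Lm D d<n

  BTLam-irreducible : BTLam n H T → (D : T →β⊥ N) → ¬ argument-depth D < n
  BTLam-irreducible Lm (⊥unsv _ u _) _ = u (BTLam-solvable Lm)
  BTLam-irreducible Lm (⊥lam e _) _
    with _ , Lm' ← BTLam-lam⁻¹ Lm e = BTLam-≉-bot Lm' ≈-refl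
  BTLam-irreducible Lm (ξlam e D _) d<n
    with _ , Lm' ← BTLam-lam⁻¹ Lm e = BTLam-irreducible Lm' D d<n
  BTLam-irreducible Lm (β₀ e _) _
    with _ , _ , S , _ ← BTLam-app⁻¹ Lm e = BTSpine-≉-lam S ≈-refl
  BTLam-irreducible Lm (⊥app e _) _
    with _ , _ , S , _ ← BTLam-app⁻¹ Lm e = BTSpine-≉-bot S ≈-refl
  BTLam-irreducible Lm (ξl e D _) d<n
    with _ , _ , S , _ ← BTLam-app⁻¹ Lm e = BTLam-irreducible (btl-spine S) D d<n
  BTLam-irreducible Lm (ξr e D _) d<n
    with _ , _ , _ , A ← BTLam-app⁻¹ Lm e = BTArg-irreducible A D d<n

  BTArg-irreducible : BTArg n M T → (D : T →β⊥ N) → ¬ suc (argument-depth D) < n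
  BTArg-irreducible (more b) D (s≤s d<n) = IsBT-irreducible b D d<n

lemma5p15 : (M : Tm) → WF M → BotFree M → (T : Tm) → IsBT M T →
            ¬ (Σ Tm λ N → T →β⊥ N)
lemma5p15 M _ _ T bt (N , D) = IsBT-irreducible (bt (suc (argument-depth D))) D (n<1+n _)
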